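{- Let $G$ be an $n$-vertex graph in which every connected component has at most $n/3$ vertices. Then there exist disjoint vertex sets $A,B\subseteq V(G)$ with $|A|,|B|\ge n/3$ such that no vertex of $A$ is adjacent to any vertex of $B$. -}

module Defs where

open import Level using (0ℓ)
open import Data.Nat using (ℕ; _*_; _≤_)
open import Data.Fin using (Fin)
open import Data.Fin.Subset using (Subset; _∈_; ∣_∣)
open import Data.List using (List; length)
open import Data.List.Relation.Unary.All using (All)
open import Data.List.Relation.Unary.Unique.Propositional using (Unique)
open import Relation.Binary.Core using (Rel)
open import Relation.Binary.Definitions using (Symmetric; Irreflexive; Decidable)
open import Relation.Binary.PropositionalEquality using (_≡_)
open import Relation.Nullary using (¬_)
open import Data.Product using (_×_)

record Graph (n : ℕ) : Set₁ where
  field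
    Adj      : Rel (Fin n) 0ℓ
    sym      : Symmetric Adj
    irrefl   : Irreflexive _≡_ Adj
    adj?     : Decidable Adj

data Reach {n : ℕ} (G : Graph n) : Fin n → Fin n → Set where
  here : ∀ {v} → Reach G v v
  step : ∀ {u w v} → Graph.Adj G u w → Reach G w v → Reach G u v

-- The connected component of v has at most n/3 vertices, i.e. 3·|C(v)| ≤ n:
-- every list of distinct vertices reachable from v has length k with 3·k ≤ n.
ComponentAtMostThird : {n : ℕ} → Graph n → Fin n → Set
ComponentAtMostThird {n} G v =
  (xs : List (Fin n)) → Unique xs → All (Reach G v) xs → 3 * length xs ≤ n

NoEdgesBetween : {n : ℕ} → Graph n → Subset n → Subset n → Set
NoEdgesBetween G A B = ∀ a b → a ∈ A → b ∈ B → ¬ Graph.Adj G a b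

Disjoint : {n : ℕ} → Subset n → Subset n → Set
Disjoint A B = ∀ x → x ∈ A → ¬ (x ∈ B)

-- Add the components of the vertices to a set one vertex at a time. Each step
-- adds at most one component, so 3·|set| grows by at most n, from 0 up to 3n;
-- hence at some stage n ≤ 3·|set| ≤ 2n. That set A is closed
-- under adjacency, so it has no edges to its complement B, and |B| ≥ n/3.
module Submission where

open import Defs
open import Data.Nat using (ℕ; _*_; _≤_)
open import Data.Fin.Subset using (Subset; ∣_∣)
open import Data.Product using (Σ-syntax; _×_)

open import Data.Nat using (suc; _+_; _<_; _∸_; z≤n; s≤s; _≤?_)
open import Data.Nat.Properties
open import Data.Fin using (Fin; zero; suc)
open import Data.Fin.Properties using (any?) renaming (suc-injective to Fin-suc-injective)
open import Data.Fin.Subset using (_∈_; _⊆_; ⊥; ⊤; ⁅_⁆; _∪_; ⋃; ∁; inside; outside)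
open import Data.Fin.Subset.Properties
open import Data.Vec using ([]; _∷_; tabulate; here; there)
open import Data.Vec.Properties using (lookup∘tabulate; []=⇒lookup; lookup⇒[]=)
open import Data.List using (List; []; _∷_; length; map; allFin)
open import Data.List.Properties using (length-map)
open import Data.List.Membership.Propositional using () renaming (_∈_ to _∈ₗ_)
open import Data.List.Membership.Propositional.Properties using (∈-allFin)
open import Data.List.Relation.Unary.All as All using (All; []; _∷_)
open import Data.List.Relation.Unary.All.Properties using (map⁺)
open import Data.List.Relation.Unary.Any using (here; there)
open import Data.List.Relation.Unary.Unique.Propositional using (Unique; []; _∷_)
import Data.List.Relation.Unary.Unique.Propositional.Properties as Unique
open import Data.Product using (_,_; ∃-syntax)
open import Data.Sum using (inj₁; inj₂)
open import Data.Empty using (⊥-elim)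
open import Relation.Nullary using (yes; no; does)
open import Relation.Nullary.Decidable using (_×-dec_; dec-true)
open import Relation.Unary using (Pred; Decidable)
open import Relation.Binary.PropositionalEquality using (_≡_; refl; sym; trans; cong; subst)

threshold-crossing : ∀ {a} {A : Set a} (f : List A → ℕ) {t c : ℕ} (xs : List A) →
                     f [] ≤ t → t ≤ f xs → (∀ y ys → f (y ∷ ys) ≤ f ys + c) →
                     ∃[ ys ] (t ≤ f ys × f ys ≤ t + c)
threshold-crossing f []       f[]≤t t≤f _ = [] , t≤f , ≤-trans f[]≤t (m≤m+n _ _)
threshold-crossing f {t} (x ∷ xs) f[]≤t t≤f grows with t ≤? f xs
... | yes t≤f′ = threshold-crossing f xs f[]≤t t≤f′ grows
... | no  t≰f′ = x ∷ xs , t≤f , ≤-trans (grows x xs) (+-monoˡ-≤ _ (<⇒≤ (≰⇒> t≰f′)))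

3*m≤n+n⇒n≤3*[n∸m] : ∀ n m → 3 * m ≤ n + n → n ≤ 3 * (n ∸ m)
3*m≤n+n⇒n≤3*[n∸m] n m 3m≤2n = +-cancelʳ-≤ (3 * m) n (3 * (n ∸ m)) (begin
  n + 3 * m            ≤⟨ +-monoʳ-≤ n 3m≤2n ⟩
  n + (n + n)          ≡⟨ cong (λ k → n + (n + k)) (sym (+-identityʳ n)) ⟩
  3 * n                ≡⟨ cong (3 *_) (sym (m∸n+n≡m m≤n)) ⟩
  3 * (n ∸ m + m)      ≡⟨ *-distribˡ-+ 3 (n ∸ m) m ⟩
  3 * (n ∸ m) + 3 * m  ∎)
  where
  open ≤-Reasoning
  m≤n : m ≤ n
  m≤n = *-cancelˡ-≤ 3 (≤-trans 3m≤2n (+-monoʳ-≤ n (m≤m+n n (n + 0))))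

∣p∪q∣≤∣p∣+∣q∣ : ∀ {n} (p q : Subset n) → ∣ p ∪ q ∣ ≤ ∣ p ∣ + ∣ q ∣
∣p∪q∣≤∣p∣+∣q∣ []            []            = z≤n
∣p∪q∣≤∣p∣+∣q∣ (inside  ∷ p) (inside  ∷ q) = s≤s (≤-trans (∣p∪q∣≤∣p∣+∣q∣ p q) (+-monoʳ-≤ ∣ p ∣ (n≤1+n ∣ q ∣)))
∣p∪q∣≤∣p∣+∣q∣ (inside  ∷ p) (outside ∷ q) = s≤s (∣p∪q∣≤∣p∣+∣q∣ p q)
∣p∪q∣≤∣p∣+∣q∣ (outside ∷ p) (inside  ∷ q) = ≤-trans (s≤s (∣p∪q∣≤∣p∣+∣q∣ p q)) (≤-reflexive (sym (+-suc ∣ p ∣ ∣ q ∣)))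
∣p∪q∣≤∣p∣+∣q∣ (outside ∷ p) (outside ∷ q) = ∣p∪q∣≤∣p∣+∣q∣ p q

enumerate : ∀ {n} (p : Subset n) →
            Σ[ xs ∈ List (Fin n) ] (Unique xs × All (_∈ p) xs × length xs ≡ ∣ p ∣)
enumerate []      = [] , [] , [] , refl
enumerate (s ∷ p) with enumerate p
enumerate (inside ∷ p) | xs , distinct , xs⊆p , len =
  zero ∷ map suc xs ,
  map⁺ (All.tabulate (λ _ ())) ∷ Unique.map⁺ Fin-suc-injective distinct ,
  here ∷ map⁺ (All.map there xs⊆p) ,
  cong suc (trans (length-map suc xs) len)
enumerate (outside ∷ p) | xs , distinct , xs⊆p , len =
  map suc xs ,
  Unique.map⁺ Fin-suc-injective distinct ,
  map⁺ (All.map there xs⊆p) ,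
  trans (length-map suc xs) len

satisfying : ∀ {n ℓ} {P : Pred (Fin n) ℓ} → Decidable P → Subset n
satisfying P? = tabulate (λ x → does (P? x))

∈-satisfying⁺ : ∀ {n ℓ} {P : Pred (Fin n) ℓ} (P? : Decidable P) {x} → P x → x ∈ satisfying P?
∈-satisfying⁺ P? {x} px = lookup⇒[]= x _ (trans (lookup∘tabulate _ x) (dec-true (P? x) px))

∈-satisfying⁻ : ∀ {n ℓ} {P : Pred (Fin n) ℓ} (P? : Decidable P) {x} → x ∈ satisfying P? → P x
∈-satisfying⁻ P? {x} x∈ with P? x | trans (sym (lookup∘tabulate _ x)) ([]=⇒lookup x∈)
... | yes px | _ = px
... | no  _  | ()

module _ {n : ℕ} (G : Graph n) where
  open Graph G using (Adj; adj?)

  Reach-trans : ∀ {u v w} → Reach G u v → Reach G v w → Reach G u w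
  Reach-trans here        v⇝w = v⇝w
  Reach-trans (step uv r) v⇝w = step uv (Reach-trans r v⇝w)

  Closed : Subset n → Set
  Closed S = ∀ {x y} → x ∈ S → Adj x y → y ∈ S

  ∪-closed : ∀ {S T} → Closed S → Closed T → Closed (S ∪ T)
  ∪-closed {S} {T} S-closed T-closed x∈S∪T xy with x∈p∪q⁻ S T x∈S∪T
  ... | inj₁ x∈S = x∈p∪q⁺ (inj₁ (S-closed x∈S xy))
  ... | inj₂ x∈T = x∈p∪q⁺ (inj₂ (T-closed x∈T xy))

  AdjacentTo : Subset n → Pred (Fin n) _
  AdjacentTo S y = ∃[ x ] (x ∈ S × Adj x y)

  adjacentTo? : ∀ S → Decidable (AdjacentTo S)
  adjacentTo? S y = any? (λ x → (x ∈? S) ×-dec adj? x y)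

  neighbours : Subset n → Subset n
  neighbours S = satisfying (adjacentTo? S)

  expand : Subset n → Subset n
  expand S = S ∪ neighbours S

  ⊆-expand : ∀ S → S ⊆ expand S
  ⊆-expand S = p⊆p∪q (neighbours S)

  adj∈expand : ∀ {S x y} → x ∈ S → Adj x y → y ∈ expand S
  adj∈expand x∈S xy = x∈p∪q⁺ (inj₂ (∈-satisfying⁺ (adjacentTo? _) (_ , x∈S , xy)))

  expand-reach : ∀ S {y} → y ∈ expand S → ∃[ x ] (x ∈ S × Reach G x y)
  expand-reach S y∈ with x∈p∪q⁻ S (neighbours S) y∈
  ... | inj₁ y∈S = _ , y∈S , here
  ... | inj₂ y∈N with ∈-satisfying⁻ (adjacentTo? S) y∈N
  ...   | x , x∈S , xy = x , x∈S , step xy here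

  expandFor : ℕ → Subset n → Subset n
  expandFor 0       S = S
  expandFor (suc k) S with S ⊂? expand S
  ... | yes _ = expandFor k (expand S)
  ... | no  _ = S

  ⊆-expandFor : ∀ k S → S ⊆ expandFor k S
  ⊆-expandFor 0       S x∈S = x∈S
  ⊆-expandFor (suc k) S x∈S with S ⊂? expand S
  ... | yes _ = ⊆-expandFor k (expand S) (⊆-expand S x∈S)
  ... | no  _ = x∈S

  expandFor-reach : ∀ k S {y} → y ∈ expandFor k S → ∃[ x ] (x ∈ S × Reach G x y)
  expandFor-reach 0       S y∈ = _ , y∈ , here
  expandFor-reach (suc k) S y∈ with S ⊂? expand S
  ... | no  _ = _ , y∈ , here
  ... | yes _ with expandFor-reach k (expand S) y∈
  ...   | z , z∈ , z⇝y with expand-reach S z∈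
  ...     | x , x∈S , x⇝z = x , x∈S , Reach-trans x⇝z z⇝y

  -- Every productive round adds a vertex, so n < |S| + k rounds always suffice.
  expandFor-closed : ∀ k S → n < ∣ S ∣ + k → Closed (expandFor k S)
  expandFor-closed 0 S n<∣S∣+0 =
    ⊥-elim (<⇒≱ n<∣S∣+0 (≤-trans (≤-reflexive (+-identityʳ ∣ S ∣)) (∣p∣≤n S)))
  expandFor-closed (suc k) S n<∣S∣+1+k with S ⊂? expand S
  ... | yes S⊂ = expandFor-closed k (expand S) (begin-strict
    n                     <⟨ n<∣S∣+1+k ⟩
    ∣ S ∣ + suc k         ≡⟨ +-suc ∣ S ∣ k ⟩
    suc ∣ S ∣ + k         ≤⟨ +-monoˡ-≤ k (p⊂q⇒∣p∣<∣q∣ S⊂) ⟩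
    ∣ expand S ∣ + k      ∎)
    where open ≤-Reasoning
  ... | no S⊄ = S-closed
    where
    S-closed : Closed S
    S-closed {y = y} x∈S xy with y ∈? S
    ... | yes y∈S = y∈S
    ... | no  y∉S = ⊥-elim (S⊄ (⊆-expand S , y , adj∈expand x∈S xy , y∉S))

  component : Fin n → Subset n
  component v = expandFor (suc n) ⁅ v ⁆

  ∈-component : ∀ v → v ∈ component v
  ∈-component v = ⊆-expandFor (suc n) ⁅ v ⁆ (x∈⁅x⁆ v)

  component-closed : ∀ v → Closed (component v)
  component-closed v = expandFor-closed (suc n) ⁅ v ⁆ (m≤n+m (suc n) ∣ ⁅ v ⁆ ∣)

  component-reach : ∀ v {x} → x ∈ component v → Reach G v x
  component-reach v x∈ with expandFor-reach (suc n) ⁅ v ⁆ x∈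
  ... | u , u∈⁅v⁆ , u⇝x = subst (λ w → Reach G w _) (x∈⁅y⁆⇒x≡y v u∈⁅v⁆) u⇝x

  3*∣component∣≤n : ∀ v → ComponentAtMostThird G v → 3 * ∣ component v ∣ ≤ n
  3*∣component∣≤n v small with enumerate (component v)
  ... | xs , distinct , xs⊆C , len =
    subst (λ k → 3 * k ≤ n) len (small xs distinct (All.map (component-reach v) xs⊆C))

  components : List (Fin n) → Subset n
  components vs = ⋃ (map component vs)

  components-closed : ∀ vs → Closed (components vs)
  components-closed []       x∈⊥ _ = ⊥-elim (∉⊥ x∈⊥)
  components-closed (v ∷ vs) = ∪-closed (component-closed v) (components-closed vs)

  ∈-components : ∀ {v vs} → v ∈ₗ vs → v ∈ components vs
  ∈-components {v} (here refl) = x∈p∪q⁺ (inj₁ (∈-component v))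
  ∈-components     (there v∈vs) = x∈p∪q⁺ (inj₂ (∈-components v∈vs))

  n≤∣components-allFin∣ : n ≤ ∣ components (allFin n) ∣
  n≤∣components-allFin∣ = begin
    n                              ≡⟨ sym (∣⊤∣≡n n) ⟩
    ∣ ⊤ {n} ∣                      ≤⟨ p⊆q⇒∣p∣≤∣q∣ {p = ⊤} (λ {v} _ → ∈-components (∈-allFin v)) ⟩
    ∣ components (allFin n) ∣      ∎
    where open ≤-Reasoning

  3*∣components∣-step : (∀ v → ComponentAtMostThird G v) →
                        ∀ v vs → 3 * ∣ components (v ∷ vs) ∣ ≤ 3 * ∣ components vs ∣ + n
  3*∣components∣-step small v vs = begin
    3 * ∣ component v ∪ components vs ∣           ≤⟨ *-monoʳ-≤ 3 (∣p∪q∣≤∣p∣+∣q∣ (component v) (components vs)) ⟩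
    3 * (∣ component v ∣ + ∣ components vs ∣)     ≡⟨ *-distribˡ-+ 3 ∣ component v ∣ ∣ components vs ∣ ⟩
    3 * ∣ component v ∣ + 3 * ∣ components vs ∣   ≤⟨ +-monoˡ-≤ _ (3*∣component∣≤n v (small v)) ⟩
    n + 3 * ∣ components vs ∣                     ≡⟨ +-comm n _ ⟩
    3 * ∣ components vs ∣ + n                     ∎
    where open ≤-Reasoning

lemma3p5 : (n : ℕ) (G : Graph n)
    → (∀ v → ComponentAtMostThird G v)
    → Σ[ A ∈ Subset n ] Σ[ B ∈ Subset n ]
    (Disjoint A B × n ≤ 3 * ∣ A ∣ × n ≤ 3 * ∣ B ∣ × NoEdgesBetween G A B)
lemma3p5 n G small with threshold-crossing (λ vs → 3 * ∣ components G vs ∣) (allFin n)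
                          3*∣⊥∣≤n n≤3*∣V∣ (3*∣components∣-step G small)
  where
  3*∣⊥∣≤n : 3 * ∣ ⊥ {n} ∣ ≤ n
  3*∣⊥∣≤n = subst (λ k → 3 * k ≤ n) (sym (∣⊥∣≡0 n)) z≤n
  n≤3*∣V∣ : n ≤ 3 * ∣ components G (allFin n) ∣
  n≤3*∣V∣ = ≤-trans (m≤n*m n 3) (*-monoʳ-≤ 3 (n≤∣components-allFin∣ G))
... | vs , n≤3∣A∣ , 3∣A∣≤2n =
  A , ∁ A ,
  (λ _ → x∈p⇒x∉∁p) ,
  n≤3∣A∣ ,
  subst (λ k → n ≤ 3 * k) (sym (∣∁p∣≡n∸∣p∣ A)) (3*m≤n+n⇒n≤3*[n∸m] n ∣ A ∣ 3∣A∣≤2n) ,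
  λ _ _ a∈A b∈∁A ab → x∈∁p⇒x∉p b∈∁A (components-closed G vs a∈A ab)
  where
  A = components G vs
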